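{- The nim-number of $\mathsf{DNG}(\mathbb{Z}_2)$ is $1$. If $n\ge 3$, then the nim-number of $\mathsf{DNG}(\mathbb{Z}_n)$ is $1$ if $n$ is odd, $0$ if $n\equiv 0\pmod 4$, and $3$ if $n\equiv 2\pmod 4$.
   Context: For a nontrivial finite group $G$, the avoidance game $\mathsf{DNG}(G)$ is the impartial game (normal play) whose positions are the subsets $P\subseteq G$ with $\langle P\rangle\neq G$ ($\langle\emptyset\rangle$ is trivial), starting position $\emptyset$, and options $\operatorname{Opt}(P)=\{P\cup\{g\}: g\in G\setminus P,\ \langle P\cup\{g\}\rangle\neq G\}$. The nim-number is $\operatorname{nim}(P)=\operatorname{mex}\{\operatorname{nim}(Q):Q\in\operatorname{Opt}(P)\}$ ($\operatorname{mex}(A)$ = least nonnegative integer not in $A$), and the nim-number of the game is $\operatorname{nim}(\emptyset)$. $\mathbb{Z}_n$ denotes the cyclic group of order $n$. -}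

module Defs where

open import Data.Nat using (ℕ; zero; suc; _∸_; _<_; NonZero)
import Data.Nat as ℕ
open import Data.Nat.DivMod using (_mod_)
open import Data.Fin using (Fin; toℕ)
open import Data.Fin.Subset using (Subset; _∈_; _∉_; _∪_; ⁅_⁆; ∣_∣; ⊥)
open import Data.Product using (Σ; ∃; _×_)
open import Relation.Nullary using (¬_)
open import Relation.Binary.PropositionalEquality using (_≡_)

module Zn (n : ℕ) .{{_ : NonZero n}} where

  0ₙ : Fin n
  0ₙ = 0 mod n

  _⊕_ : Fin n → Fin n → Fin n
  x ⊕ y = (toℕ x ℕ.+ toℕ y) mod n

  ⊖_ : Fin n → Fin n
  ⊖ x = (n ∸ toℕ x) mod n

  data ⟨_⟩ (P : Subset n) : Fin n → Set where
    gen : ∀ {x} → x ∈ P → ⟨ P ⟩ x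
    idn : ⟨ P ⟩ 0ₙ
    add : ∀ {x y} → ⟨ P ⟩ x → ⟨ P ⟩ y → ⟨ P ⟩ (x ⊕ y)
    inv : ∀ {x} → ⟨ P ⟩ x → ⟨ P ⟩ (⊖ x)

  Generates : Subset n → Set
  Generates P = ∀ g → ⟨ P ⟩ g

  Opt : Subset n → Subset n → Set
  Opt P Q = Σ (Fin n) λ g → g ∉ P × Q ≡ P ∪ ⁅ g ⁆ × ¬ Generates Q

  -- NimAt d P k : "nim(P) = k", i.e. k = mex { nim(Q) : Q ∈ Opt(P) },
  -- defined by recursion on d = n ∸ ∣P∣ (options have one more element).
  -- When d = 0, P is the whole group, so it has no options and nim = 0.
  NimAt : ℕ → Subset n → ℕ → Set
  NimAt zero    P k = k ≡ 0
  NimAt (suc d) P k =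
    ((j : ℕ) → j < k → Σ (Subset n) λ Q → Opt P Q × NimAt d Q j)
    × ((Q : Subset n) → Opt P Q → ¬ NimAt d Q k)

  NimIs : Subset n → ℕ → Set
  NimIs P k = NimAt (n ∸ ∣ P ∣) P k

DNG-nim-is : (n : ℕ) .{{_ : NonZero n}} → ℕ → Set
DNG-nim-is n k = Zn.NimIs n ⊥ k

-- A subset P of ℤₙ generates exactly the multiples of index P = gcd (n, P), a subgroup with
-- n / index P elements. So P is a position iff index P ≠ 1, and a position can be extended
-- inside the subgroup of multiples of any divisor e ≠ 1 of n that divides all of P, as long
-- as P is smaller than that subgroup. Nim-numbers are computed by exhibiting a function that
-- satisfies the mex equation on every position.
--   If n / e is odd for every divisor e ≠ 1 of n (n odd, or n = 2), nim(P) = 1 iff ∣P∣ is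
-- even. If 4 ∣ n, nim(P) = 1 iff ∣P∣ is odd: an odd-size P lies in a subgroup of even order,
-- either ⟨P⟩ itself or the multiples of 2.
--   If n = 2m with m odd, nim(P) is parity ∣P∣ when index P is odd, parity (∣P∣ + 1) when
-- index P = 2, and 2 + parity (∣P∣ + 1) for any other even index: from such a P, adding 2
-- or m reaches both values 0 and 1. The empty set has index n, hence nim-number 3.

module Submission where

open import Defs
open import Data.Bool using (Bool; true; false; if_then_else_)
open import Data.Fin as Fin using (Fin; toℕ)
open import Data.Fin.Properties using (any?; toℕ-fromℕ<; toℕ-injective; toℕ<n)
open import Data.Fin.Subset using (Subset; ⊥; inside; outside; _∈_; _∉_; _⊆_; _∪_; ⁅_⁆; ∣_∣)
open import Data.Fin.Subset.Properties using (_∈?_; ⊆-antisym; ∪-identityʳ; ∣p∣≤n; p⊆p∪q; x∈p∪q⁻; x∈p∪q⁺; x∈⁅x⁆; x∈⁅y⁆⇒x≡y; ∉⊥; ∣⊥∣≡0)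
open import Data.List using (List; foldr; map; filter; allFin) renaming ([] to []ˡ; _∷_ to _∷ˡ_)
open import Data.List.Membership.Propositional using () renaming (_∈_ to _∈ˡ_)
open import Data.List.Membership.Propositional.Properties using (∈-map⁺; ∈-map⁻; ∈-filter⁺; ∈-filter⁻; ∈-allFin)
open import Data.List.Relation.Unary.Any using (here; there)
open import Data.Nat using (ℕ; zero; suc; pred; _+_; _*_; _∸_; _≤_; _<_; _%_; z≤n; s≤s; NonZero; >-nonZero; >-nonZero⁻¹)
open import Data.Nat.Base using (parity)
open import Data.Nat.DivMod using (_mod_; _/_; m≡m%n+[m/n]*n; m%n<n; m<n⇒m%n≡m; %-distribˡ-+; [m+kn]%n≡m%n; n%n≡0)
open import Data.Nat.Divisibility
open import Data.Nat.GCD using (gcd; gcd[m,n]∣m; gcd[m,n]∣n; gcd-greatest; gcd-GCD; module Bézout)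
open import Data.Nat.Properties
open import Data.Parity.Base using (Parity; 0ℙ; 1ℙ; _⁻¹)
open import Data.Parity.Properties using (suc-homo-⁻¹; *-homo-*; ⁻¹-selfInverse)
import Data.Parity.Properties as ℙ
open import Data.Product using (_×_; ∃; _,_; proj₁; proj₂; map₂)
open import Data.Sum using (_⊎_; inj₁; inj₂)
open import Data.Vec using (_∷_; tabulate)
import Data.Vec as Vec
open import Data.Vec.Properties using (lookup∘tabulate; tabulate-cong; []=⇒lookup; lookup⇒[]=)
open import Function using (_∘_)
open import Relation.Binary.Definitions using (tri<; tri≈; tri>)
open import Relation.Binary.PropositionalEquality using (_≡_; _≢_; refl; sym; trans; cong; cong₂; subst; ≢-sym; module ≡-Reasoning)
open import Relation.Nullary using (¬_; Dec; does; yes; no; contradiction)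
open import Relation.Nullary.Decidable using (decidable-stable; dec-true; dec-false; _×-dec_; ¬?)

bit : Parity → ℕ
bit 0ℙ = 0
bit 1ℙ = 1

bit≤1 : ∀ p → bit p ≤ 1
bit≤1 0ℙ = z≤n
bit≤1 1ℙ = s≤s z≤n

bit-⁻¹≢ : ∀ p → bit (p ⁻¹) ≢ bit p
bit-⁻¹≢ 0ℙ ()
bit-⁻¹≢ 1ℙ ()

parity-suc : ∀ k → parity (suc k) ≡ parity k ⁻¹
parity-suc k = sym (⁻¹-selfInverse (suc-homo-⁻¹ k))

bit-parity-suc≢ : ∀ k → bit (parity (suc k)) ≢ bit (parity k)
bit-parity-suc≢ k rewrite parity-suc k = bit-⁻¹≢ (parity k)

j<bit⇒ : ∀ {j} p → j < bit p → j ≡ 0 × p ≡ 1ℙ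
j<bit⇒ 1ℙ (s≤s z≤n) = refl , refl

bit-cover : ∀ k {j} → j < 2 → j ≡ bit (parity k) ⊎ j ≡ bit (parity (suc k))
bit-cover k j<2 rewrite parity-suc k with parity k | j<2
... | 0ℙ | s≤s z≤n       = inj₁ refl
... | 0ℙ | s≤s (s≤s z≤n) = inj₂ refl
... | 1ℙ | s≤s z≤n       = inj₂ refl
... | 1ℙ | s≤s (s≤s z≤n) = inj₁ refl

j<2+bit⇒ : ∀ p {j} → j < 2 + bit p → j < 2 ⊎ (j ≡ 2 × p ≡ 1ℙ)
j<2+bit⇒ 0ℙ j<2                     = inj₁ j<2
j<2+bit⇒ 1ℙ (s≤s z≤n)               = inj₁ (s≤s z≤n)
j<2+bit⇒ 1ℙ (s≤s (s≤s z≤n))         = inj₁ (s≤s (s≤s z≤n))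
j<2+bit⇒ 1ℙ (s≤s (s≤s (s≤s z≤n)))   = inj₂ (refl , refl)

parity≡0ℙ⇒2∣ : ∀ m → parity m ≡ 0ℙ → 2 ∣ m
parity≡0ℙ⇒2∣ zero          _ = 2 ∣0
parity≡0ℙ⇒2∣ (suc (suc m)) p = ∣m∣n⇒∣m+n ∣-refl (parity≡0ℙ⇒2∣ m p)

2∣⇒parity≡0ℙ : ∀ {m} → 2 ∣ m → parity m ≡ 0ℙ
2∣⇒parity≡0ℙ (divides q refl) = trans (*-homo-* q 2) (ℙ.*-zeroʳ (parity q))

parity-*≡1ℙ⇒ʳ : ∀ a b → parity (a * b) ≡ 1ℙ → parity b ≡ 1ℙ
parity-*≡1ℙ⇒ʳ a b p rewrite *-homo-* a b with parity a
... | 1ℙ = p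

parity-*≡1ℙ⇒ˡ : ∀ a b → parity (a * b) ≡ 1ℙ → parity a ≡ 1ℙ
parity-*≡1ℙ⇒ˡ a b p = parity-*≡1ℙ⇒ʳ b a (subst (λ x → parity x ≡ 1ℙ) (*-comm a b) p)

parity-odd-*ˡ : ∀ a b → parity a ≡ 1ℙ → parity (a * b) ≡ parity b
parity-odd-*ˡ a b a-odd rewrite *-homo-* a b | a-odd = refl

suc-odd⇒even : ∀ k → parity (suc k) ≡ 1ℙ → parity k ≡ 0ℙ
suc-odd⇒even k 1+k-odd = sym (⁻¹-selfInverse (trans (sym (parity-suc k)) 1+k-odd))

odd⇒suc-even : ∀ k → parity k ≡ 1ℙ → parity (suc k) ≡ 0ℙ
odd⇒suc-even k k-odd = trans (parity-suc k) (cong _⁻¹ k-odd)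

parities-differ : ∀ {a b} → parity a ≡ 1ℙ → parity b ≡ 0ℙ → a ≢ b
parities-differ a-odd b-even refl = contradiction (trans (sym a-odd) b-even) λ ()

∣2⇒≢1⇒≡2 : ∀ {d} → d ∣ 2 → d ≢ 1 → d ≡ 2
∣2⇒≢1⇒≡2 {0}                 0∣2 _   = contradiction (0∣⇒≡0 0∣2) λ ()
∣2⇒≢1⇒≡2 {1}                 _   d≢1 = contradiction refl d≢1
∣2⇒≢1⇒≡2 {2}                 _   _   = refl
∣2⇒≢1⇒≡2 {suc (suc (suc d))} d∣2 _   = contradiction (∣⇒≤ d∣2) λ { (s≤s (s≤s ())) }

∣-parity-1ℙ : ∀ {d m} → d ∣ m → parity m ≡ 1ℙ → parity d ≡ 1ℙ
∣-parity-1ℙ (divides q refl) = parity-*≡1ℙ⇒ʳ q _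

countFrom : (ℕ → Bool) → ℕ → ℕ → ℕ
countFrom p s zero    = 0
countFrom p s (suc k) = (if p s then 1 else 0) + countFrom p (suc s) k

∣tabulate∣≡countFrom : ∀ k s (p : ℕ → Bool) →
                       ∣ tabulate {n = k} (λ i → p (s + toℕ i)) ∣ ≡ countFrom p s k
∣tabulate∣≡countFrom zero    s p = refl
∣tabulate∣≡countFrom (suc k) s p
  rewrite +-identityʳ s
        | tabulate-cong {n = k} (λ i → cong p (+-suc s (toℕ i)))
        | ∣tabulate∣≡countFrom k (suc s) p
  with p s
... | true  = refl
... | false = refl

countFrom-+ : ∀ p s a b → countFrom p s (a + b) ≡ countFrom p s a + countFrom p (a + s) b
countFrom-+ p s zero    b = refl
countFrom-+ p s (suc a) b rewrite countFrom-+ p (suc s) a b | +-suc a s =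
  sym (+-assoc (if p s then 1 else 0) _ _)

countFrom-false : ∀ p s k → (∀ j → j < k → p (s + j) ≡ false) → countFrom p s k ≡ 0
countFrom-false p s zero    _ = refl
countFrom-false p s (suc k) h rewrite subst (λ x → p x ≡ false) (+-identityʳ s) (h 0 (s≤s z≤n)) =
  countFrom-false p (suc s) k (λ j j<k → trans (cong p (sym (+-suc s j))) (h (suc j) (s≤s j<k)))

multiples : ∀ {n} → ℕ → Subset n
multiples e = tabulate (λ i → does (e ∣? toℕ i))

∈-multiples⁺ : ∀ {n e} {x : Fin n} → e ∣ toℕ x → x ∈ multiples e
∈-multiples⁺ {e = e} {x} e∣x =
  lookup⇒[]= x _ (trans (lookup∘tabulate _ x) (dec-true (e ∣? toℕ x) e∣x))

∈-multiples⁻ : ∀ {n e} {x : Fin n} → x ∈ multiples e → e ∣ toℕ x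
∈-multiples⁻ {e = e} {x} x∈ with e ∣? toℕ x | trans (sym (lookup∘tabulate _ x)) ([]=⇒lookup x∈)
... | yes e∣x | _  = e∣x
... | no  _   | ()

module _ (e′ : ℕ) where
  private
    e = suc e′
    multiple? : ℕ → Bool
    multiple? j = does (e ∣? j)

  countFrom-multiple?-period : ∀ t → countFrom multiple? (t * e) e ≡ 1
  countFrom-multiple?-period t
    rewrite dec-true (e ∣? t * e) (n∣m*n t) = cong suc (countFrom-false multiple? _ e′ none)
    where
    none : ∀ j → j < e′ → multiple? (suc (t * e) + j) ≡ false
    none j j<e′ = dec-false (e ∣? _) λ e∣ →
      <⇒≱ (s≤s j<e′) (∣⇒≤ (∣m+n∣m⇒∣n (subst (e ∣_) (sym (+-suc (t * e) j)) e∣) (n∣m*n t)))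

  countFrom-multiple? : ∀ q t → countFrom multiple? (t * e) (q * e) ≡ q
  countFrom-multiple? zero    t = refl
  countFrom-multiple? (suc q) t = begin
    countFrom multiple? (t * e) (e + q * e)
      ≡⟨ countFrom-+ multiple? (t * e) e (q * e) ⟩
    countFrom multiple? (t * e) e + countFrom multiple? (suc t * e) (q * e)
      ≡⟨ cong₂ _+_ (countFrom-multiple?-period t) (countFrom-multiple? q (suc t)) ⟩
    suc q ∎
    where open ≡-Reasoning

∣multiples∣*e≡n : ∀ {n} e → e ∣ n → ∣ multiples {n} e ∣ * e ≡ n
∣multiples∣*e≡n {n} zero (divides q refl) = trans (*-zeroʳ ∣ multiples {n} 0 ∣) (sym (*-zeroʳ q))
∣multiples∣*e≡n (suc e′) (divides q refl) =
  cong (_* suc e′) (trans (∣tabulate∣≡countFrom (q * suc e′) 0 _) (countFrom-multiple? e′ q 0))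

x∉p⇒∣p∪⁅x⁆∣≡1+∣p∣ : ∀ {n} (p : Subset n) x → x ∉ p → ∣ p ∪ ⁅ x ⁆ ∣ ≡ suc ∣ p ∣
x∉p⇒∣p∪⁅x⁆∣≡1+∣p∣ (outside ∷ p) Fin.zero    _   = cong (suc ∘ ∣_∣) (∪-identityʳ p)
x∉p⇒∣p∪⁅x⁆∣≡1+∣p∣ (inside  ∷ p) Fin.zero    x∉p = contradiction Vec.here x∉p
x∉p⇒∣p∪⁅x⁆∣≡1+∣p∣ (outside ∷ p) (Fin.suc x) x∉p = x∉p⇒∣p∪⁅x⁆∣≡1+∣p∣ p x (x∉p ∘ Vec.there)
x∉p⇒∣p∪⁅x⁆∣≡1+∣p∣ (inside  ∷ p) (Fin.suc x) x∉p = cong suc (x∉p⇒∣p∪⁅x⁆∣≡1+∣p∣ p x (x∉p ∘ Vec.there))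

x∈p∪⁅x⁆ : ∀ {n} (p : Subset n) x → x ∈ p ∪ ⁅ x ⁆
x∈p∪⁅x⁆ p x = x∈p∪q⁺ (inj₂ (x∈⁅x⁆ x))

∪⁅⁆⊆ : ∀ {n} {p q : Subset n} {x} → p ⊆ q → x ∈ q → p ∪ ⁅ x ⁆ ⊆ q
∪⁅⁆⊆ {p = p} {x = x} p⊆q x∈q y∈ with x∈p∪q⁻ p ⁅ x ⁆ y∈
... | inj₁ y∈p = p⊆q y∈p
... | inj₂ y∈⁅x⁆ rewrite x∈⁅y⁆⇒x≡y x y∈⁅x⁆ = x∈q

∣p∣≢∣q∣⇒∃∈q∖p : ∀ {n} {p q : Subset n} → p ⊆ q → ∣ p ∣ ≢ ∣ q ∣ → ∃ λ x → x ∈ q × x ∉ p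
∣p∣≢∣q∣⇒∃∈q∖p {p = p} {q} p⊆q ∣p∣≢∣q∣ with any? (λ x → x ∈? q ×-dec ¬? (x ∈? p))
... | yes found = found
... | no  none  = contradiction (cong ∣_∣ (⊆-antisym p⊆q q⊆p)) ∣p∣≢∣q∣
  where
  q⊆p : q ⊆ p
  q⊆p {x} x∈q = decidable-stable (x ∈? p) (λ x∉p → none (x , x∈q , x∉p))

module _ {s : ℕ} where

  foldr-gcd-∣ : ∀ ls {a} → a ∈ˡ ls → foldr gcd s ls ∣ a
  foldr-gcd-∣ (b ∷ˡ ls) (here refl) = gcd[m,n]∣m b _
  foldr-gcd-∣ (b ∷ˡ ls) (there a∈) = ∣-trans (gcd[m,n]∣n b _) (foldr-gcd-∣ ls a∈)

  foldr-gcd-∣-seed : ∀ ls → foldr gcd s ls ∣ s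
  foldr-gcd-∣-seed []ˡ        = ∣-refl
  foldr-gcd-∣-seed (b ∷ˡ ls) = ∣-trans (gcd[m,n]∣n b _) (foldr-gcd-∣-seed ls)

  foldr-gcd-closed : (R : ℕ → Set) → (∀ {a b} → R a → R b → R (gcd a b)) →
                     R s → ∀ ls → (∀ {a} → a ∈ˡ ls → R a) → R (foldr gcd s ls)
  foldr-gcd-closed R closed Rs []ˡ        _  = Rs
  foldr-gcd-closed R closed Rs (b ∷ˡ ls) Rls =
    closed (Rls (here refl)) (foldr-gcd-closed R closed Rs ls (Rls ∘ there))

module Subgroups (n : ℕ) .{{_ : NonZero n}} where
  open Zn n

  toℕ-mod : ∀ a → toℕ (a mod n) ≡ a % n
  toℕ-mod a = toℕ-fromℕ< (m%n<n a n)

  mod-cong : ∀ {a b} → a % n ≡ b % n → a mod n ≡ b mod n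
  mod-cong {a} {b} eq = toℕ-injective (trans (toℕ-mod a) (trans eq (sym (toℕ-mod b))))

  toℕ-mod-< : ∀ {a} → a < n → toℕ (a mod n) ≡ a
  toℕ-mod-< a<n = trans (toℕ-mod _) (m<n⇒m%n≡m a<n)

  toℕ-mod-inverse : ∀ x → toℕ x mod n ≡ x
  toℕ-mod-inverse x = toℕ-injective (toℕ-mod-< (toℕ<n x))

  ⊕-mod : ∀ a b → (a mod n) ⊕ (b mod n) ≡ (a + b) mod n
  ⊕-mod a b = mod-cong (begin
    (toℕ (a mod n) + toℕ (b mod n)) % n ≡⟨ cong₂ (λ u v → (u + v) % n) (toℕ-mod a) (toℕ-mod b) ⟩
    (a % n + b % n) % n               ≡⟨ %-distribˡ-+ a b n ⟨
    (a + b) % n                       ∎)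
    where open ≡-Reasoning

  ∣-toℕ-mod : ∀ {d a} → d ∣ n → d ∣ a → d ∣ toℕ (a mod n)
  ∣-toℕ-mod {d} {a} d∣n d∣a = subst (d ∣_) (sym (toℕ-mod a)) (%-presˡ-∣ d∣a d∣n)

  ⟨⟩⊆multiples : ∀ {d P x} → d ∣ n → P ⊆ multiples d → ⟨ P ⟩ x → d ∣ toℕ x
  ⟨⟩⊆multiples d∣n P⊆ (gen x∈P) = ∈-multiples⁻ (P⊆ x∈P)
  ⟨⟩⊆multiples d∣n P⊆ idn       = ∣-toℕ-mod d∣n (_ ∣0)
  ⟨⟩⊆multiples d∣n P⊆ (add p q) =
    ∣-toℕ-mod d∣n (∣m∣n⇒∣m+n (⟨⟩⊆multiples d∣n P⊆ p) (⟨⟩⊆multiples d∣n P⊆ q))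
  ⟨⟩⊆multiples d∣n P⊆ (inv {x} p) = ∣-toℕ-mod d∣n (∣m+n∣m⇒∣n d∣x+[n∸x] (⟨⟩⊆multiples d∣n P⊆ p))
    where d∣x+[n∸x] = subst (_ ∣_) (sym (m+[n∸m]≡n (<⇒≤ (toℕ<n x)))) d∣n

  module _ (P : Subset n) where

    Reaches : ℕ → Set
    Reaches a = ⟨ P ⟩ (a mod n)

    reaches-+ : ∀ {a b} → Reaches a → Reaches b → Reaches (a + b)
    reaches-+ {a} {b} ra rb = subst ⟨ P ⟩ (⊕-mod a b) (add ra rb)

    reaches-* : ∀ k {a} → Reaches a → Reaches (k * a)
    reaches-* zero    ra = idn
    reaches-* (suc k) ra = reaches-+ ra (reaches-* k ra)

    reaches-+*n : ∀ a k → Reaches (a + k * n) → Reaches a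
    reaches-+*n a k = subst ⟨ P ⟩ (mod-cong ([m+kn]%n≡m%n a k n))

    -- −yb is reached as (n − 1)·yb.
    reaches-bézout : ∀ {a b g} x y → g + y * b ≡ x * a → Reaches a → Reaches b → Reaches g
    reaches-bézout {a} {b} {g} x y eq ra rb =
      reaches-+*n g (y * b) (subst Reaches combination
        (reaches-+ (reaches-* x ra) (reaches-* (pred n) (reaches-* y rb))))
      where
      open ≡-Reasoning
      combination : x * a + pred n * (y * b) ≡ g + y * b * n
      combination = begin
        x * a + pred n * (y * b)         ≡⟨ cong (_+ pred n * (y * b)) eq ⟨
        g + y * b + pred n * (y * b)     ≡⟨ +-assoc g (y * b) _ ⟩
        g + suc (pred n) * (y * b)       ≡⟨ cong (λ k → g + k * (y * b)) (suc-pred n) ⟩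
        g + n * (y * b)                  ≡⟨ cong (g +_) (*-comm n (y * b)) ⟩
        g + y * b * n                    ∎

    reaches-gcd : ∀ {a b} → Reaches a → Reaches b → Reaches (gcd a b)
    reaches-gcd {a} {b} ra rb with Bézout.identity (gcd-GCD a b)
    ... | Bézout.+- x y eq = reaches-bézout x y eq ra rb
    ... | Bézout.-+ x y eq = reaches-bézout y x eq rb ra

    elements : List ℕ
    elements = map toℕ (filter (_∈? P) (allFin n))

    index : ℕ
    index = foldr gcd n elements

    ∈-elements⁺ : ∀ {x} → x ∈ P → toℕ x ∈ˡ elements
    ∈-elements⁺ {x} x∈P = ∈-map⁺ toℕ (∈-filter⁺ (_∈? P) (∈-allFin x) x∈P)

    ∈-elements⁻ : ∀ {a} → a ∈ˡ elements → ∃ λ x → x ∈ P × a ≡ toℕ x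
    ∈-elements⁻ a∈ with ∈-map⁻ toℕ a∈
    ... | x , x∈ , refl = x , proj₂ (∈-filter⁻ (_∈? P) {xs = allFin n} x∈) , refl

    index∣n : index ∣ n
    index∣n = foldr-gcd-∣-seed elements

    ⊆-multiples-index : P ⊆ multiples index
    ⊆-multiples-index x∈P = ∈-multiples⁺ (foldr-gcd-∣ elements (∈-elements⁺ x∈P))

    ∣-index : ∀ {d} → d ∣ n → P ⊆ multiples d → d ∣ index
    ∣-index {d} d∣n P⊆ = foldr-gcd-closed (d ∣_) gcd-greatest d∣n elements d∣elements
      where
      d∣elements : ∀ {a} → a ∈ˡ elements → d ∣ a
      d∣elements a∈ with ∈-elements⁻ a∈
      ... | x , x∈P , refl = ∈-multiples⁻ (P⊆ x∈P)

    reaches-index : Reaches index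
    reaches-index = foldr-gcd-closed Reaches reaches-gcd reaches-n elements reaches-elements
      where
      reaches-n : Reaches n
      reaches-n = subst ⟨ P ⟩ (mod-cong (trans (m<n⇒m%n≡m (>-nonZero⁻¹ n)) (sym (n%n≡0 n)))) idn
      reaches-elements : ∀ {a} → a ∈ˡ elements → Reaches a
      reaches-elements a∈ with ∈-elements⁻ a∈
      ... | x , x∈P , refl = subst ⟨ P ⟩ (sym (toℕ-mod-inverse x)) (gen x∈P)

  index-antitone : ∀ {P Q} → P ⊆ Q → index Q ∣ index P
  index-antitone P⊆Q = ∣-index _ (index∣n _) (⊆-multiples-index _ ∘ P⊆Q)

  index∣toℕ : ∀ P {x} → x ∈ P → index P ∣ toℕ x
  index∣toℕ P = ∈-multiples⁻ ∘ ⊆-multiples-index P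

  ⊆-multiples-∣index : ∀ P {e} → e ∣ index P → P ⊆ multiples e
  ⊆-multiples-∣index P e∣index = ∈-multiples⁺ ∘ ∣-trans e∣index ∘ index∣toℕ P

  index≡1⇒generates : ∀ P → index P ≡ 1 → Generates P
  index≡1⇒generates P index≡1 g =
    subst ⟨ P ⟩ (trans (cong (_mod n) (*-identityʳ (toℕ g))) (toℕ-mod-inverse g))
      (reaches-* P (toℕ g) (subst (Reaches P) index≡1 (reaches-index P)))

  ¬generates⇒index≢1 : ∀ {P} → ¬ Generates P → index P ≢ 1
  ¬generates⇒index≢1 {P} ¬gen = ¬gen ∘ index≡1⇒generates P

  module _ (1<n : 1 < n) where

    generates⇒index≡1 : ∀ P → Generates P → index P ≡ 1
    generates⇒index≡1 P gen-all = ∣1⇒≡1 (subst (index P ∣_) (toℕ-mod-< 1<n)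
      (⟨⟩⊆multiples (index∣n P) (⊆-multiples-index P) (gen-all (1 mod n))))

    ⊆-multiples⇒¬generates : ∀ {d P} → d ∣ n → d ≢ 1 → P ⊆ multiples d → ¬ Generates P
    ⊆-multiples⇒¬generates d∣n d≢1 P⊆ gen-all =
      d≢1 (∣1⇒≡1 (subst (_ ∣_) (generates⇒index≡1 _ gen-all) (∣-index _ d∣n P⊆)))

module Nim (n : ℕ) .{{_ : NonZero n}} where
  open Zn n

  NimAt-functional : ∀ d P {a b} → NimAt d P a → NimAt d P b → a ≡ b
  NimAt-functional zero    P a≡0 b≡0 = trans a≡0 (sym b≡0)
  NimAt-functional (suc d) P {a} {b} (below-a , not-a) (below-b , not-b) with <-cmp a b
  ... | tri< a<b _ _ = let Q , opt , nimQ = below-b a a<b in contradiction nimQ (not-a Q opt)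
  ... | tri≈ _ a≡b _ = a≡b
  ... | tri> _ _ b<a = let Q , opt , nimQ = below-a b b<a in contradiction nimQ (not-b Q opt)

  ∣option∣ : ∀ {P Q} → Opt P Q → ∣ Q ∣ ≡ suc ∣ P ∣
  ∣option∣ {P} (g , g∉P , refl , _) = x∉p⇒∣p∪⁅x⁆∣≡1+∣p∣ P g g∉P

  option-¬generates : ∀ {P Q} → Opt P Q → ¬ Generates Q
  option-¬generates (_ , _ , _ , ¬gen) = ¬gen

  option-⊇ : ∀ {P Q} → Opt P Q → P ⊆ Q
  option-⊇ (g , _ , refl , _) = p⊆p∪q _

  MexEquation : (Subset n → ℕ) → Subset n → Set
  MexEquation v P = (∀ j → j < v P → ∃ λ Q → Opt P Q × v Q ≡ j) × (∀ Q → Opt P Q → v Q ≢ v P)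

  module _ (v : Subset n → ℕ) (mex : ∀ P → ¬ Generates P → MexEquation v P) where

    mex⇒NimAt : ∀ d P → n ∸ ∣ P ∣ ≡ d → ¬ Generates P → NimAt d P (v P)
    mex⇒NimAt zero P full ¬gen with v P | proj₁ (mex P ¬gen)
    ... | zero  | _       = refl
    ... | suc _ | options = let Q , opt , _ = options 0 (s≤s z≤n) in
      contradiction (m∸n≡0⇒m≤n full) (<⇒≱ (subst (_≤ n) (∣option∣ opt) (∣p∣≤n Q)))
    mex⇒NimAt (suc d) P room ¬gen = below , not-at
      where
      room-option : ∀ {Q} → Opt P Q → n ∸ ∣ Q ∣ ≡ d
      room-option {Q} opt = begin
        n ∸ ∣ Q ∣            ≡⟨ cong (n ∸_) (∣option∣ opt) ⟩
        n ∸ suc ∣ P ∣        ≡⟨ pred[m∸n]≡m∸[1+n] n ∣ P ∣ ⟨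
        pred (n ∸ ∣ P ∣)     ≡⟨ cong pred room ⟩
        d                    ∎
        where open ≡-Reasoning
      nim-option : ∀ {Q} → Opt P Q → NimAt d Q (v Q)
      nim-option {Q} opt = mex⇒NimAt d Q (room-option opt) (option-¬generates opt)
      below : ∀ j → j < v P → ∃ λ Q → Opt P Q × NimAt d Q j
      below j j<v = let Q , opt , vQ≡j = proj₁ (mex P ¬gen) j j<v in
        Q , opt , subst (NimAt d Q) vQ≡j (nim-option opt)
      not-at : ∀ Q → Opt P Q → ¬ NimAt d Q (v P)
      not-at Q opt nimQ = proj₂ (mex P ¬gen) Q opt (NimAt-functional d Q (nim-option opt) nimQ)

    mex⇒NimIs : ∀ P → ¬ Generates P → NimIs P (v P)
    mex⇒NimIs P = mex⇒NimAt (n ∸ ∣ P ∣) P refl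

module Game (n : ℕ) .{{_ : NonZero n}} (1<n : 1 < n) where
  open Zn n
  open Subgroups n
  open Nim n

  option-within : ∀ {P e} → e ∣ n → e ≢ 1 → P ⊆ multiples e → ∣ P ∣ ≢ ∣ multiples {n} e ∣ →
                  ∃ λ Q → Opt P Q × Q ⊆ multiples e
  option-within e∣n e≢1 P⊆ ∣P∣≢ with ∣p∣≢∣q∣⇒∃∈q∖p P⊆ ∣P∣≢
  ... | x , x∈ , x∉P = _ , (x , x∉P , refl , ⊆-multiples⇒¬generates 1<n e∣n e≢1 Q⊆) , Q⊆
    where Q⊆ = ∪⁅⁆⊆ P⊆ x∈

  option-index-∣ : ∀ {P Q} → Opt P Q → index Q ∣ index P
  option-index-∣ = index-antitone ∘ option-⊇

  ¬generates-⊥ : ¬ Generates ⊥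
  ¬generates-⊥ = ⊆-multiples⇒¬generates 1<n ∣-refl (>⇒≢ 1<n) (λ x∈⊥ → contradiction x∈⊥ ∉⊥)

  nim-by-parity : ∀ r → (∀ P → ¬ Generates P → parity (r + ∣ P ∣) ≡ 1ℙ → ∃ (Opt P)) →
                  NimIs ⊥ (bit (parity r))
  nim-by-parity r has-option =
    subst (λ k → NimIs ⊥ (bit (parity k))) (trans (cong (r +_) (∣⊥∣≡0 n)) (+-identityʳ r))
      (mex⇒NimIs v mex ⊥ ¬generates-⊥)
    where
    v : Subset n → ℕ
    v P = bit (parity (r + ∣ P ∣))
    v-option : ∀ {P Q} → Opt P Q → v Q ≡ bit (parity (suc (r + ∣ P ∣)))
    v-option {P} opt =
      cong (λ k → bit (parity k)) (trans (cong (r +_) (∣option∣ opt)) (+-suc r ∣ P ∣))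
    mex : ∀ P → ¬ Generates P → MexEquation v P
    mex P ¬gen = below , (λ Q opt → bit-parity-suc≢ (r + ∣ P ∣) ∘ trans (sym (v-option opt)))
      where
      below : ∀ j → j < v P → ∃ λ Q → Opt P Q × v Q ≡ j
      below j j<v with j<bit⇒ (parity (r + ∣ P ∣)) j<v
      ... | refl , r+∣P∣-odd with has-option P ¬gen r+∣P∣-odd
      ...   | Q , opt = Q , opt , trans (v-option opt) (cong bit (odd⇒suc-even (r + ∣ P ∣) r+∣P∣-odd))

  nim-when-quotients-odd : (∀ e → e ∣ n → e ≢ 1 → parity ∣ multiples {n} e ∣ ≡ 1ℙ) → NimIs ⊥ 1
  nim-when-quotients-odd quotient-odd = nim-by-parity 1 has-option
    where
    has-option : ∀ P → ¬ Generates P → parity (suc ∣ P ∣) ≡ 1ℙ → ∃ (Opt P)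
    has-option P ¬gen 1+∣P∣-odd =
      map₂ proj₁ (option-within (index∣n P) index≢1 (⊆-multiples-index P) ∣P∣≢)
      where
      index≢1 = ¬generates⇒index≢1 ¬gen
      ∣P∣≢ : ∣ P ∣ ≢ ∣ multiples {n} (index P) ∣
      ∣P∣≢ = ≢-sym (parities-differ (quotient-odd (index P) (index∣n P) index≢1)
                                    (suc-odd⇒even ∣ P ∣ 1+∣P∣-odd))

  nim-when-odd : parity n ≡ 1ℙ → NimIs ⊥ 1
  nim-when-odd n-odd = nim-when-quotients-odd λ e e∣n _ →
    parity-*≡1ℙ⇒ˡ ∣ multiples {n} e ∣ e
      (subst (λ a → parity a ≡ 1ℙ) (sym (∣multiples∣*e≡n e e∣n)) n-odd)

  nim-when-4∣n : 4 ∣ n → NimIs ⊥ 0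
  nim-when-4∣n 4∣n = nim-by-parity 0 has-option
    where
    2∣n : 2 ∣ n
    2∣n = ∣-trans (divides 2 refl) 4∣n
    ∣multiples-2∣-even : parity ∣ multiples {n} 2 ∣ ≡ 0ℙ
    ∣multiples-2∣-even = 2∣⇒parity≡0ℙ (*-cancelʳ-∣ {2} {∣ multiples {n} 2 ∣} 2
      (subst (4 ∣_) (sym (∣multiples∣*e≡n {n} 2 2∣n)) 4∣n))
    has-option : ∀ P → ¬ Generates P → parity ∣ P ∣ ≡ 1ℙ → ∃ (Opt P)
    has-option P ¬gen ∣P∣-odd with parity ∣ multiples {n} (index P) ∣ in quotient
    ... | 0ℙ = map₂ proj₁ (option-within (index∣n P) (¬generates⇒index≢1 ¬gen) (⊆-multiples-index P)
                 (parities-differ ∣P∣-odd quotient))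
    ... | 1ℙ = map₂ proj₁ (option-within 2∣n (λ ()) P⊆evens
                 (parities-differ ∣P∣-odd ∣multiples-2∣-even))
      where
      index-even : parity (index P) ≡ 0ℙ
      index-even = begin
        parity (index P)     ≡⟨ parity-odd-*ˡ k (index P) quotient ⟨
        parity (k * index P) ≡⟨ cong parity (∣multiples∣*e≡n {n} (index P) (index∣n P)) ⟩
        parity n             ≡⟨ 2∣⇒parity≡0ℙ 2∣n ⟩
        0ℙ                   ∎
        where
        open ≡-Reasoning
        k = ∣ multiples {n} (index P) ∣
      P⊆evens : P ⊆ multiples 2
      P⊆evens = ⊆-multiples-∣index P (parity≡0ℙ⇒2∣ (index P) index-even)

data Kind : Set where
  odd two otherEven : Kind

kindOf : Parity → Bool → Kind
kindOf 1ℙ _     = odd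
kindOf 0ℙ true  = two
kindOf 0ℙ false = otherEven

kind : ℕ → Kind
kind e = kindOf (parity e) (does (e ≟ 2))

kind-odd : ∀ e → parity e ≡ 1ℙ → kind e ≡ odd
kind-odd e p rewrite p = refl

kind-otherEven : ∀ e → parity e ≡ 0ℙ → e ≢ 2 → kind e ≡ otherEven
kind-otherEven e p e≢2 rewrite p | dec-false (e ≟ 2) e≢2 = refl

-- nim-number of a position of size k in ℤ₂ₘ (m odd) whose index has the given kind
value : Kind → ℕ → ℕ
value odd       k = bit (parity k)
value two       k = bit (parity (suc k))
value otherEven k = 2 + bit (parity (suc k))

value-suc≢otherEven : ∀ κ k → value κ (suc k) ≢ value otherEven k
value-suc≢otherEven odd       k eq = contradiction (subst (_≤ 1) eq (bit≤1 _)) λ { (s≤s ()) }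
value-suc≢otherEven two       k eq = contradiction (subst (_≤ 1) eq (bit≤1 _)) λ { (s≤s ()) }
value-suc≢otherEven otherEven k eq = bit-parity-suc≢ (suc k) (suc-injective (suc-injective eq))

module TwiceOdd (n : ℕ) .{{_ : NonZero n}} (m : ℕ) (n≡m*2 : n ≡ m * 2)
                (m-odd : parity m ≡ 1ℙ) (1<m : 1 < m) where
  open Zn n
  open Subgroups n

  instance
    m-nonZero : NonZero m
    m-nonZero = >-nonZero (<-trans (s≤s z≤n) 1<m)

  m<n : m < n
  m<n = subst (m <_) (sym n≡m*2) (m<m*n m 2 (s≤s (s≤s z≤n)))

  1<n : 1 < n
  1<n = <-trans 1<m m<n

  2<n : 2 < n
  2<n = subst (2 <_) (sym n≡m*2) (<-≤-trans (s≤s (s≤s (s≤s z≤n))) (*-monoˡ-≤ 2 1<m))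

  2∣n : 2 ∣ n
  2∣n = divides m n≡m*2

  m∣n : m ∣ n
  m∣n = divides 2 (trans n≡m*2 (*-comm m 2))

  open Nim n
  open Game n 1<n

  2ₙ mₙ : Fin n
  2ₙ = 2 mod n
  mₙ = m mod n

  even-divisor : ∀ {e} → e ∣ n → parity e ≡ 0ℙ → ∃ λ d → e ≡ d * 2 × d ∣ m
  even-divisor {e} e∣n e-even with parity≡0ℙ⇒2∣ e e-even
  ... | divides d refl = d , refl , *-cancelʳ-∣ {d} {m} 2 (subst (d * 2 ∣_) n≡m*2 e∣n)

  odd⇒∣multiples∣-even : ∀ {e} → e ∣ n → parity e ≡ 1ℙ → parity ∣ multiples {n} e ∣ ≡ 0ℙ
  odd⇒∣multiples∣-even {e} e∣n e-odd = begin
    parity k         ≡⟨ parity-odd-*ˡ e k e-odd ⟨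
    parity (e * k)   ≡⟨ cong parity (trans (*-comm e k) (∣multiples∣*e≡n e e∣n)) ⟩
    parity n         ≡⟨ 2∣⇒parity≡0ℙ 2∣n ⟩
    0ℙ               ∎
    where
    open ≡-Reasoning
    k = ∣ multiples {n} e ∣

  even⇒∣multiples∣-odd : ∀ {e} → e ∣ n → parity e ≡ 0ℙ → parity ∣ multiples {n} e ∣ ≡ 1ℙ
  even⇒∣multiples∣-odd {e} e∣n e-even with even-divisor e∣n e-even
  ... | d , refl , _ = parity-*≡1ℙ⇒ˡ k d (subst (λ a → parity a ≡ 1ℙ) (sym k*d≡m) m-odd)
    where
    k = ∣ multiples {n} (d * 2) ∣
    k*d≡m : k * d ≡ m
    k*d≡m = *-cancelʳ-≡ (k * d) m 2
      (trans (*-assoc k d 2) (trans (∣multiples∣*e≡n (d * 2) e∣n) n≡m*2))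

  v : Subset n → ℕ
  v P = value (kind (index P)) ∣ P ∣

  v-option : ∀ {P Q} → Opt P Q → v Q ≡ value (kind (index Q)) (suc ∣ P ∣)
  v-option {Q = Q} opt = cong (value (kind (index Q))) (∣option∣ opt)

  mex-odd : ∀ P → ¬ Generates P → parity (index P) ≡ 1ℙ → MexEquation v P
  mex-odd P ¬gen index-odd = below , differs
    where
    vP : v P ≡ bit (parity ∣ P ∣)
    vP = cong (λ κ → value κ ∣ P ∣) (kind-odd (index P) index-odd)
    vQ : ∀ {Q} → Opt P Q → v Q ≡ bit (parity (suc ∣ P ∣))
    vQ {Q} opt = trans (v-option opt) (cong (λ κ → value κ (suc ∣ P ∣))
      (kind-odd (index Q) (∣-parity-1ℙ (option-index-∣ opt) index-odd)))
    differs : ∀ Q → Opt P Q → v Q ≢ v P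
    differs Q opt eq = bit-parity-suc≢ ∣ P ∣ (trans (sym (vQ opt)) (trans eq vP))
    below : ∀ j → j < v P → ∃ λ Q → Opt P Q × v Q ≡ j
    below j j<v with j<bit⇒ (parity ∣ P ∣) (subst (j <_) vP j<v)
    ... | refl , ∣P∣-odd
      with option-within (index∣n P) (¬generates⇒index≢1 ¬gen) (⊆-multiples-index P)
             (parities-differ ∣P∣-odd (odd⇒∣multiples∣-even (index∣n P) index-odd))
    ...   | Q , opt , _ = Q , opt , trans (vQ opt) (cong bit (odd⇒suc-even ∣ P ∣ ∣P∣-odd))

  mex-two : ∀ P → ¬ Generates P → index P ≡ 2 → MexEquation v P
  mex-two P ¬gen index≡2 = below , differs
    where
    vP : v P ≡ bit (parity (suc ∣ P ∣))
    vP = cong (λ e → value (kind e) ∣ P ∣) index≡2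
    vQ : ∀ {Q} → Opt P Q → v Q ≡ bit (parity ∣ P ∣)
    vQ {Q} opt = trans (v-option opt) (cong (λ e → value (kind e) (suc ∣ P ∣)) index-Q≡2)
      where
      index-Q≡2 = ∣2⇒≢1⇒≡2 (subst (index Q ∣_) index≡2 (option-index-∣ opt))
                            (¬generates⇒index≢1 (option-¬generates opt))
    differs : ∀ Q → Opt P Q → v Q ≢ v P
    differs Q opt eq = bit-parity-suc≢ ∣ P ∣ (sym (trans (sym (vQ opt)) (trans eq vP)))
    below : ∀ j → j < v P → ∃ λ Q → Opt P Q × v Q ≡ j
    below j j<v with j<bit⇒ (parity (suc ∣ P ∣)) (subst (j <_) vP j<v)
    ... | refl , 1+∣P∣-odd
      with option-within 2∣n (λ ()) (⊆-multiples-∣index P (∣-reflexive (sym index≡2)))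
             (≢-sym (parities-differ (even⇒∣multiples∣-odd 2∣n refl) (suc-odd⇒even ∣ P ∣ 1+∣P∣-odd)))
    ...   | Q , opt , _ = Q , opt , trans (vQ opt) (cong bit (suc-odd⇒even ∣ P ∣ 1+∣P∣-odd))

  module _ (P : Subset n) (¬gen : ¬ Generates P)
           (index-even : parity (index P) ≡ 0ℙ) (index≢2 : index P ≢ 2) where

    2∣index : 2 ∣ index P
    2∣index = parity≡0ℙ⇒2∣ (index P) index-even

    kind-P : kind (index P) ≡ otherEven
    kind-P = kind-otherEven (index P) index-even index≢2

    option-adding-2 : ∃ λ Q → Opt P Q × v Q ≡ bit (parity ∣ P ∣)
    option-adding-2 =
      Q , opt , trans (v-option opt) (cong (λ e → value (kind e) (suc ∣ P ∣)) index-Q≡2)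
      where
      Q = P ∪ ⁅ 2ₙ ⁆
      index∣2 : ∀ {R} → 2ₙ ∈ R → index R ∣ 2
      index∣2 {R} 2ₙ∈R = subst (index R ∣_) (toℕ-mod-< 2<n) (index∣toℕ R 2ₙ∈R)
      2ₙ∉P : 2ₙ ∉ P
      2ₙ∉P 2ₙ∈P = index≢2 (∣2⇒≢1⇒≡2 (index∣2 2ₙ∈P) (¬generates⇒index≢1 ¬gen))
      Q⊆evens : Q ⊆ multiples 2
      Q⊆evens = ∪⁅⁆⊆ (⊆-multiples-∣index P 2∣index)
                     (∈-multiples⁺ (subst (2 ∣_) (sym (toℕ-mod-< 2<n)) ∣-refl))
      opt : Opt P Q
      opt = 2ₙ , 2ₙ∉P , refl , ⊆-multiples⇒¬generates 1<n 2∣n (λ ()) Q⊆evens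
      index-Q≡2 : index Q ≡ 2
      index-Q≡2 = ∣2⇒≢1⇒≡2 (index∣2 (x∈p∪⁅x⁆ P 2ₙ)) (¬generates⇒index≢1 (option-¬generates opt))

    option-adding-m : ∃ λ Q → Opt P Q × v Q ≡ bit (parity (suc ∣ P ∣))
    option-adding-m with even-divisor (index∣n P) index-even
    ... | d , index≡d*2 , d∣m =
      Q , opt , trans (v-option opt) (cong (λ κ → value κ (suc ∣ P ∣))
                                       (kind-odd (index Q) index-Q-odd))
      where
      Q = P ∪ ⁅ mₙ ⁆
      mₙ∉P : mₙ ∉ P
      mₙ∉P mₙ∈P = parities-differ {m} m-odd (2∣⇒parity≡0ℙ
        (∣-trans 2∣index (subst (index P ∣_) (toℕ-mod-< m<n) (index∣toℕ P mₙ∈P)))) refl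
      d≢1 : d ≢ 1
      d≢1 refl = index≢2 index≡d*2
      Q⊆ : Q ⊆ multiples d
      Q⊆ = ∪⁅⁆⊆ (⊆-multiples-∣index P (subst (d ∣_) (sym index≡d*2) (m∣m*n 2)))
                (∈-multiples⁺ (subst (d ∣_) (sym (toℕ-mod-< m<n)) d∣m))
      opt : Opt P Q
      opt = mₙ , mₙ∉P , refl , ⊆-multiples⇒¬generates 1<n (∣-trans d∣m m∣n) d≢1 Q⊆
      index-Q-odd : parity (index Q) ≡ 1ℙ
      index-Q-odd =
        ∣-parity-1ℙ (subst (index Q ∣_) (toℕ-mod-< m<n) (index∣toℕ Q (x∈p∪⁅x⁆ P mₙ))) m-odd

    option-keeping-index : parity ∣ P ∣ ≡ 0ℙ → ∃ λ Q → Opt P Q × v Q ≡ 2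
    option-keeping-index ∣P∣-even
      with option-within (index∣n P) (¬generates⇒index≢1 ¬gen) (⊆-multiples-index P)
             (≢-sym (parities-differ (even⇒∣multiples∣-odd (index∣n P) index-even) ∣P∣-even))
    ... | Q , opt , Q⊆ = Q , opt , (begin
      v Q                                ≡⟨ v-option opt ⟩
      value (kind (index Q)) (suc ∣ P ∣) ≡⟨ cong (λ e → value (kind e) (suc ∣ P ∣)) index-Q≡index-P ⟩
      value (kind (index P)) (suc ∣ P ∣) ≡⟨ cong (λ κ → value κ (suc ∣ P ∣)) kind-P ⟩
      2 + bit (parity ∣ P ∣)             ≡⟨ cong (λ p → 2 + bit p) ∣P∣-even ⟩
      2                                  ∎)
      where
      open ≡-Reasoning
      index-Q≡index-P = ∣-antisym (option-index-∣ opt) (∣-index Q (index∣n P) Q⊆)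

    mex-otherEven : MexEquation v P
    mex-otherEven = below , differs
      where
      vP : v P ≡ value otherEven ∣ P ∣
      vP = cong (λ κ → value κ ∣ P ∣) kind-P
      differs : ∀ Q → Opt P Q → v Q ≢ v P
      differs Q opt eq =
        value-suc≢otherEven (kind (index Q)) ∣ P ∣ (trans (sym (v-option opt)) (trans eq vP))
      below : ∀ j → j < v P → ∃ λ Q → Opt P Q × v Q ≡ j
      below j j<v with j<2+bit⇒ (parity (suc ∣ P ∣)) (subst (j <_) vP j<v)
      ... | inj₂ (refl , 1+∣P∣-odd) = option-keeping-index (suc-odd⇒even ∣ P ∣ 1+∣P∣-odd)
      ... | inj₁ j<2 with bit-cover ∣ P ∣ j<2
      ...   | inj₁ refl = option-adding-2
      ...   | inj₂ refl = option-adding-m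

  mex : ∀ P → ¬ Generates P → MexEquation v P
  mex P ¬gen = by-parity (parity (index P)) refl (index P ≟ 2)
    where
    by-parity : ∀ p → parity (index P) ≡ p → Dec (index P ≡ 2) → MexEquation v P
    by-parity 1ℙ index-odd  _             = mex-odd P ¬gen index-odd
    by-parity 0ℙ _          (yes index≡2) = mex-two P ¬gen index≡2
    by-parity 0ℙ index-even (no index≢2)  = mex-otherEven P ¬gen index-even index≢2

  nim-twice-odd : NimIs ⊥ 3
  nim-twice-odd = subst (NimIs ⊥) v⊥≡3 (mex⇒NimIs v mex ⊥ ¬generates-⊥)
    where
    open ≡-Reasoning
    index-⊥ : index ⊥ ≡ n
    index-⊥ = ∣-antisym (index∣n ⊥) (∣-index ⊥ ∣-refl (λ x∈⊥ → contradiction x∈⊥ ∉⊥))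
    v⊥≡3 : v ⊥ ≡ 3
    v⊥≡3 = begin
      v ⊥                ≡⟨ cong₂ (λ e k → value (kind e) k) index-⊥ (∣⊥∣≡0 n) ⟩
      value (kind n) 0   ≡⟨ cong (λ κ → value κ 0) (kind-otherEven n (2∣⇒parity≡0ℙ 2∣n) (>⇒≢ 2<n)) ⟩
      3                  ∎

%2≡1⇒parity≡1ℙ : ∀ n → n % 2 ≡ 1 → parity n ≡ 1ℙ
%2≡1⇒parity≡1ℙ n n%2≡1 with parity n in n-parity
... | 1ℙ = refl
... | 0ℙ = contradiction (trans (sym n%2≡1) (n∣m⇒m%n≡0 n 2 (parity≡0ℙ⇒2∣ n n-parity))) λ ()

%4≡2⇒twice-odd : ∀ n → 3 ≤ n → n % 4 ≡ 2 → ∃ λ m → n ≡ m * 2 × parity m ≡ 1ℙ × 1 < m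
%4≡2⇒twice-odd n 3≤n n%4≡2 = suc (q * 2) , n≡ , m-odd , 1<m
  where
  open ≡-Reasoning
  q = n / 4
  n≡ : n ≡ suc (q * 2) * 2
  n≡ = begin
    n             ≡⟨ m≡m%n+[m/n]*n n 4 ⟩
    n % 4 + q * 4 ≡⟨ cong (_+ q * 4) n%4≡2 ⟩
    2 + q * 4     ≡⟨ cong (2 +_) (*-assoc q 2 2) ⟨
    2 + q * 2 * 2 ∎
  m-odd : parity (suc (q * 2)) ≡ 1ℙ
  m-odd = trans (parity-suc (q * 2)) (cong _⁻¹ (2∣⇒parity≡0ℙ (divides q refl)))
  1<m : 1 < suc (q * 2)
  1<m = ≰⇒> λ m≤1 → <⇒≱ 3≤n (subst (_≤ 2) (sym n≡) (*-monoˡ-≤ 2 m≤1))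

DNG-nim-ℤ₂ : DNG-nim-is 2 1
DNG-nim-ℤ₂ = Game.nim-when-quotients-odd 2 (s≤s (s≤s z≤n)) quotient-odd
  where
  quotient-odd : ∀ e → e ∣ 2 → e ≢ 1 → parity ∣ multiples {2} e ∣ ≡ 1ℙ
  quotient-odd e e∣2 e≢1 rewrite ∣2⇒≢1⇒≡2 e∣2 e≢1 = refl

corollary6p7 : DNG-nim-is 2 1
    × ((n : ℕ) .{{_ : NonZero n}} → 3 ≤ n →
        (n % 2 ≡ 1 → DNG-nim-is n 1)
        × (n % 4 ≡ 0 → DNG-nim-is n 0)
        × (n % 4 ≡ 2 → DNG-nim-is n 3))
corollary6p7 = DNG-nim-ℤ₂ , λ n 3≤n →
  let 1<n = <-≤-trans (s≤s (s≤s z≤n)) 3≤n in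
    (λ n%2≡1 → Game.nim-when-odd n 1<n (%2≡1⇒parity≡1ℙ n n%2≡1))
  , (λ n%4≡0 → Game.nim-when-4∣n n 1<n (m%n≡0⇒n∣m n 4 n%4≡0))
  , (λ n%4≡2 → let m , n≡m*2 , m-odd , 1<m = %4≡2⇒twice-odd n 3≤n n%4≡2 in
       TwiceOdd.nim-twice-odd n m n≡m*2 m-odd 1<m)
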